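{- Let $w\geq4$ be an integer and let $P_n=(a_n,a_{n-1})$ for $n\geq1$. Then (1) $\{P_{2n+1}: n\geq 0\}\subseteq R(w)$; (2) $\{P_{2n}: n\geq 1\}\subseteq L(w)$; (3) $\{P_n: n\geq 1\}\subseteq E(w)$.
   Context: $\mathbb{N}=\{0,1,2,\dots\}$. $C(w)=\{(x,y)\in\mathbb{R}^2: x^2-\sqrt{w}\,xy+y^2=1\}$; $L(w)=\{(u\sqrt{w},v)\in C(w): u,v\in\mathbb{N},\ u\sqrt{w}>v\}$; $R(w)=\{(u,v\sqrt{w})\in C(w): u,v\in\mathbb{N},\ u>v\sqrt{w}\}$; $E(w)=L(w)\cup R(w)$. The sequence $(a_n)$ is defined by $a_0=0$, $a_1=1$, $a_{n+1}=\sqrt{w}\,a_n-a_{n-1}$ for $n\geq1$. -}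

module Defs where

open import Data.Nat using (ℕ; zero; suc)
open import Data.Integer using (ℤ; +_; _+_; _*_; -_; _-_; _≤_; _<_)
open import Data.Product using (_×_; _,_; Σ; ∃-syntax)
open import Data.Sum using (_⊎_)
open import Relation.Nullary using (¬_)
open import Relation.Binary.PropositionalEquality using (_≡_)

-- An element (p , q) of Zs represents the real number p + q·√w
-- (w is a fixed natural parameter).  Arithmetic below is the arithmetic of
-- ℤ[X]/(X² - w), which maps homomorphically into ℝ via X ↦ √w.
Zs : Set
Zs = ℤ × ℤ

module _ (w : ℕ) where

  zs : ℤ → Zs
  zs p = (p , + 0)

  sqrtw : Zs
  sqrtw = (+ 0 , + 1)

  _⊕_ : Zs → Zs → Zs
  (p , q) ⊕ (p' , q') = (p + p' , q + q')

  ⊝_ : Zs → Zs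
  ⊝ (p , q) = (- p , - q)

  _⊖_ : Zs → Zs → Zs
  x ⊖ y = x ⊕ (⊝ y)

  _⊛_ : Zs → Zs → Zs
  (p , q) ⊛ (p' , q') = (p * p' + (+ w) * (q * q') , p * q' + q * p')

  IsZeroℝ : Zs → Set
  IsZeroℝ (p , q) = (p * p ≡ q * q * (+ w)) × (p * q ≤ + 0)

  _≈ℝ_ : Zs → Zs → Set
  x ≈ℝ y = IsZeroℝ (x ⊖ y)

  -- the real number p + q√w is > 0  (valid since √w ≥ 0; used with w ≥ 4)
  Posℝ : Zs → Set
  Posℝ (p , q) =
      (+ 0 ≤ p × + 0 ≤ q × ¬ (p ≡ + 0 × q ≡ + 0))
    ⊎ (+ 0 ≤ p × q < + 0 × q * q * (+ w) < p * p)
    ⊎ (p < + 0 × + 0 ≤ q × p * p < q * q * (+ w))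

  _>ℝ_ : Zs → Zs → Set
  x >ℝ y = Posℝ (x ⊖ y)

  Pt : Set
  Pt = Zs × Zs

  InC : Pt → Set
  InC (x , y) = (((x ⊛ x) ⊖ (sqrtw ⊛ (x ⊛ y))) ⊕ (y ⊛ y)) ≈ℝ zs (+ 1)

  InL : Pt → Set
  InL (x , y) = Σ ℕ λ u → Σ ℕ λ v →
    (x ≈ℝ (sqrtw ⊛ zs (+ u))) × (y ≈ℝ zs (+ v)) × InC (x , y)
    × ((sqrtw ⊛ zs (+ u)) >ℝ zs (+ v))

  InR : Pt → Set
  InR (x , y) = Σ ℕ λ u → Σ ℕ λ v →
    (x ≈ℝ zs (+ u)) × (y ≈ℝ (sqrtw ⊛ zs (+ v))) × InC (x , y)
    × (zs (+ u) >ℝ (sqrtw ⊛ zs (+ v)))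

  InE : Pt → Set
  InE P = InL P ⊎ InR P

  a : ℕ → Zs
  a zero = zs (+ 0)
  a (suc zero) = zs (+ 1)
  a (suc (suc n)) = (sqrtw ⊛ a (suc n)) ⊖ a n

  -- Pₙ = (aₙ , a_{n-1})  (only used for n ≥ 1)
  P : ℕ → Pt
  P zero = (a zero , a zero)
  P (suc n) = (a (suc n) , a n)

module Submission where

-- Write w = 4 + k.  The recursion a_{n+1} = √w aₙ − a_{n−1} alternates
-- between integers and integer multiples of √w:
--     a_{2n} = yₙ √w,   a_{2n+1} = uₙ = yₙ + y_{n+1},
-- where y₀ = 0, y₁ = 1 and w y_{n+1} = uₙ + u_{n+1}.  To stay inside ℕ the sequence
-- is generated from its increments dₙ = y_{n+1} − yₙ, which satisfy d₀ = 1 and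
-- d_{n+1} = k y_{n+1} + dₙ (this is where w ≥ 4 is used: the yₙ increase).
-- Consecutive terms satisfy the Vieta invariant (yₙ + y_{n+1})² = 1 + w yₙ y_{n+1},
-- which the recursion preserves exactly as in Vieta jumping.  Expanding it gives
-- uₙ² − w uₙ yₙ + w yₙ² = 1 = uₙ² − w uₙ y_{n+1} + w y_{n+1}², i.e. P_{2n+1} = (uₙ, yₙ√w)
-- and P_{2n+2} = (y_{n+1}√w, uₙ) lie on C(w); the strict inequalities defining R(w)
-- and L(w) reduce to yₙ ≤ y_{n+1} and w dₙ y_{n+1} ≥ 2.

import Defs
open import Relation.Binary.PropositionalEquality
  using (_≡_; refl; sym; trans; cong; cong₂; subst; subst₂; module ≡-Reasoning)
open import Data.List using (_∷_; [])
open import Data.Nat using (ℕ)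

module NatArith where
  open import Data.Nat using (zero; suc; _+_; _*_; _≤_; _<_)
  open import Data.Nat.Properties
    using (+-comm; *-suc; +-cancelʳ-≡; ≤-trans; m≤n+m; *-monoʳ-≤; *-mono-≤; +-monoˡ-≤; n<1+n;
           module ≤-Reasoning)
  open import Data.Nat.Tactic.RingSolver using (solve)
  open import Data.Product using (_,_; ∃-syntax)
  open import Data.Sum using (_⊎_; inj₁; inj₂)

  -- The point (p, q√w) lies on C(w):  p² − w p q + w q² = 1, written without subtraction.
  OnConic : ℕ → ℕ → ℕ → Set
  OnConic w p q = p * p + w * q * q ≡ 1 + w * p * q

  -- Vieta jumping: a and c are the two roots t of (b + t)² = 1 + w b t, their sum being
  -- (w − 2) b.  So if (a, b) satisfies the equation, so does (b, c).
  vieta-step : ∀ w a b c → w * b ≡ (a + b) + (b + c) →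
    (a + b) * (a + b) ≡ 1 + w * a * b → (b + c) * (b + c) ≡ 1 + w * b * c
  vieta-step w a b c rec inv = +-cancelʳ-≡ (w * a * b) _ _ (begin
    (b + c) * (b + c) + w * a * b                   ≡⟨ solve (a ∷ b ∷ c ∷ w ∷ []) ⟩
    (b + c) * (b + c) + (w * b) * a                 ≡⟨ cong (λ t → (b + c) * (b + c) + t * a) rec ⟩
    (b + c) * (b + c) + ((a + b) + (b + c)) * a     ≡⟨ solve (a ∷ b ∷ c ∷ []) ⟩
    (a + b) * (a + b) + ((a + b) + (b + c)) * c     ≡⟨ cong (λ t → (a + b) * (a + b) + t * c) (sym rec) ⟩
    (a + b) * (a + b) + (w * b) * c                 ≡⟨ cong (_+ (w * b) * c) inv ⟩
    1 + w * a * b + (w * b) * c                     ≡⟨ solve (a ∷ b ∷ c ∷ w ∷ []) ⟩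
    1 + w * b * c + w * a * b                       ∎)
    where open ≡-Reasoning

  onConic-left : ∀ w a b → (a + b) * (a + b) ≡ 1 + w * a * b → OnConic w (a + b) a
  onConic-left w a b inv = begin
    (a + b) * (a + b) + w * a * a   ≡⟨ cong (_+ w * a * a) inv ⟩
    1 + w * a * b + w * a * a       ≡⟨ solve (a ∷ b ∷ w ∷ []) ⟩
    1 + w * (a + b) * a             ∎
    where open ≡-Reasoning

  onConic-right : ∀ w a b → (a + b) * (a + b) ≡ 1 + w * a * b → OnConic w (a + b) b
  onConic-right w a b inv = begin
    (a + b) * (a + b) + w * b * b   ≡⟨ cong (_+ w * b * b) inv ⟩
    1 + w * a * b + w * b * b       ≡⟨ solve (a ∷ b ∷ w ∷ []) ⟩
    1 + w * (a + b) * b             ∎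
    where open ≡-Reasoning

  below : ∀ w a b → a ≤ b → (a + b) * (a + b) ≡ 1 + w * a * b →
    a * a * w < (a + b) * (a + b)
  below w a b a≤b inv = begin-strict
    a * a * w           ≡⟨ solve (a ∷ w ∷ []) ⟩
    w * a * a           ≤⟨ *-monoʳ-≤ (w * a) a≤b ⟩
    w * a * b           <⟨ n<1+n (w * a * b) ⟩
    1 + w * a * b       ≡⟨ sym inv ⟩
    (a + b) * (a + b)   ∎
    where open ≤-Reasoning

  above : ∀ w a d → 2 ≤ w → 1 ≤ d →
    (a + (a + d)) * (a + (a + d)) ≡ 1 + w * a * (a + d) →
    (a + (a + d)) * (a + (a + d)) < (a + d) * (a + d) * w
  above w a d 2≤w 1≤d inv = begin-strict
    (a + (a + d)) * (a + (a + d))        ≡⟨ inv ⟩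
    1 + w * a * (a + d)                  <⟨ n<1+n _ ⟩
    2 + w * a * (a + d)                  ≤⟨ +-monoˡ-≤ (w * a * (a + d)) 2≤wdb ⟩
    w * d * (a + d) + w * a * (a + d)    ≡⟨ solve (a ∷ d ∷ w ∷ []) ⟩
    (a + d) * (a + d) * w                ∎
    where
    open ≤-Reasoning
    2≤wdb : 2 ≤ w * d * (a + d)
    2≤wdb = *-mono-≤ (*-mono-≤ 2≤w 1≤d) (≤-trans 1≤d (m≤n+m d a))

  parity : ∀ n → (∃[ m ] n ≡ 2 * m + 1) ⊎ (∃[ m ] n ≡ 2 * m)
  parity zero = inj₂ (0 , refl)
  parity (suc n) with parity n
  ... | inj₁ (m , refl) = inj₂ (suc m , trans (cong suc (+-comm (2 * m) 1)) (sym (*-suc 2 m)))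
  ... | inj₂ (m , refl) = inj₁ (m , sym (+-comm (2 * m) 1))

module Recurrence (k : ℕ) where
  open import Data.Nat using (zero; suc; _+_; _*_; _≤_; _<_; s≤s; z≤n)
  open import Data.Nat.Properties using (≤-trans; m≤m+n; m≤n+m; *-zeroʳ)
  open import Data.Nat.Tactic.RingSolver using (solve-∀)
  open NatArith using (OnConic; vieta-step; onConic-left; onConic-right; below; above)

  w : ℕ
  w = 4 + k

  -- a_{2n} = yₙ √w, generated from the increments dₙ = y_{n+1} − yₙ.
  y d : ℕ → ℕ
  y zero    = 0
  y (suc n) = y n + d n
  d zero    = 1
  d (suc n) = k * y (suc n) + d n

  -- a_{2n+1} = uₙ
  u : ℕ → ℕ
  u n = y n + y (suc n)

  d-pos : ∀ n → 1 ≤ d n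
  d-pos zero    = s≤s z≤n
  d-pos (suc n) = ≤-trans (d-pos n) (m≤n+m (d n) (k * y (suc n)))

  -- w y_{n+1} = uₙ + u_{n+1}: the recursion a_{2n+3} = √w a_{2n+2} − a_{2n+1};
  -- as a statement about (yₙ) it says y_n + y_{n+2} = (w − 2) y_{n+1}.
  y-rec : ∀ n → w * y (suc n) ≡ u n + u (suc n)
  y-rec n = unfolded k (y n) (d n)
    where
    unfolded : ∀ k a b →
      (4 + k) * (a + b) ≡ (a + (a + b)) + ((a + b) + ((a + b) + (k * (a + b) + b)))
    unfolded = solve-∀

  vieta : ∀ n → u n * u n ≡ 1 + w * y n * y (suc n)
  vieta zero    = cong (λ t → 1 + t * 1) (sym (*-zeroʳ w))
  vieta (suc n) = vieta-step w (y n) (y (suc n)) (y (suc (suc n))) (y-rec n) (vieta n)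

  odd-onConic : ∀ n → OnConic w (u n) (y n)
  odd-onConic n = onConic-left w (y n) (y (suc n)) (vieta n)

  even-onConic : ∀ n → OnConic w (u n) (y (suc n))
  even-onConic n = onConic-right w (y n) (y (suc n)) (vieta n)

  odd-gap : ∀ n → y n * y n * w < u n * u n
  odd-gap n = below w (y n) (y (suc n)) (m≤m+n (y n) (d n)) (vieta n)

  even-gap : ∀ n → u n * u n < y (suc n) * y (suc n) * w
  even-gap n = above w (y n) (d n) (s≤s (s≤s z≤n)) (d-pos n) (vieta n)

module RootW (w : ℕ) where
  open import Data.Nat as ℕ using (zero; suc; z≤n)
  open import Data.Integer using (ℤ; +_; -_; _+_; _-_; _*_; _<_; +≤+; +<+; -<+)
  open import Data.Integer.Properties
    using (+-inverseʳ; +-identityˡ; +-identityʳ; *-identityˡ; pos-+; pos-*)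
  open import Data.Integer.Tactic.RingSolver using (solve; solve-∀)
  open import Data.Product using (_,_)
  open import Data.Sum using (inj₁; inj₂)
  open Defs using (Zs; Posℝ; InC; InR; InL)
  open NatArith using (OnConic)

  _⊛_ _⊖_ _⊕_ : Zs → Zs → Zs
  x ⊛ y = Defs._⊛_ w x y
  x ⊖ y = Defs._⊖_ w x y
  x ⊕ y = Defs._⊕_ w x y

  √w : Zs
  √w = Defs.sqrtw w

  _≈ℝ_ : Zs → Zs → Set
  x ≈ℝ y = Defs._≈ℝ_ w x y

  ≡⇒≈ℝ : {x y : Zs} → x ≡ y → x ≈ℝ y
  ≡⇒≈ℝ {p , q} refl rewrite +-inverseʳ p | +-inverseʳ q = refl , +≤+ z≤n

  -- Reflexivity; x is explicit because it cannot be inferred from the type x ≈ℝ x.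
  ≈ℝ-refl : (x : Zs) → x ≈ℝ x
  ≈ℝ-refl x = ≡⇒≈ℝ {x} refl

  -- The product of ℤ[√W] for an arbitrary integer W; `_⊛_` is the case W = + w.
  -- With W a variable, identities in ℤ[√w] become checkable by the ring solver.
  mulᵂ : ℤ → Zs → Zs → Zs
  mulᵂ W (p , q) (p' , q') = (p * p' + W * (q * q') , p * q' + q * p')

  conicᵂ : ℤ → Zs → Zs → Zs
  conicᵂ W x y = (mulᵂ W x x ⊖ mulᵂ W √w (mulᵂ W x y)) ⊕ mulᵂ W y y

  int·int : ∀ W a b → mulᵂ W (a , + 0) (b , + 0) ≡ (a * b , + 0)
  int·int W a b = cong₂ _,_ (solve (W ∷ a ∷ b ∷ [])) (solve (a ∷ b ∷ []))

  int·sqrt : ∀ W a b → mulᵂ W (a , + 0) (+ 0 , b) ≡ (+ 0 , a * b)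
  int·sqrt W a b = cong₂ _,_ (solve (W ∷ a ∷ b ∷ [])) (solve (a ∷ b ∷ []))

  sqrt·int : ∀ W a b → mulᵂ W (+ 0 , a) (b , + 0) ≡ (+ 0 , a * b)
  sqrt·int W a b = cong₂ _,_ (solve (W ∷ a ∷ b ∷ [])) (solve (a ∷ b ∷ []))

  sqrt·sqrt : ∀ W a b → mulᵂ W (+ 0 , a) (+ 0 , b) ≡ (W * (a * b) , + 0)
  sqrt·sqrt W a b = cong₂ _,_ (solve (W ∷ a ∷ b ∷ [])) (solve (a ∷ b ∷ []))

  √w·int : ∀ n → √w ⊛ (n , + 0) ≡ (+ 0 , n)
  √w·int n = trans (sqrt·int (+ w) (+ 1) n) (cong (+ 0 ,_) (*-identityˡ n))

  √w·sqrt : ∀ n → √w ⊛ (+ 0 , n) ≡ (+ w * n , + 0)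
  √w·sqrt n = trans (sqrt·sqrt (+ w) (+ 1) n) (cong (λ t → (+ w * t , + 0)) (*-identityˡ n))

  conic-int-sqrt : ∀ W p q → conicᵂ W (p , + 0) (+ 0 , q) ≡ (p * p + W * q * q - W * p * q , + 0)
  conic-int-sqrt W p q = begin
    conicᵂ W (p , + 0) (+ 0 , q)
      ≡⟨ cong₂ (λ A B → (A ⊖ mulᵂ W √w B) ⊕ mulᵂ W (+ 0 , q) (+ 0 , q)) (int·int W p p) (int·sqrt W p q) ⟩
    ((p * p , + 0) ⊖ mulᵂ W √w (+ 0 , p * q)) ⊕ mulᵂ W (+ 0 , q) (+ 0 , q)
      ≡⟨ cong₂ (λ B C → ((p * p , + 0) ⊖ B) ⊕ C) (sqrt·sqrt W (+ 1) (p * q)) (sqrt·sqrt W q q) ⟩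
    ((p * p , + 0) ⊖ (W * (+ 1 * (p * q)) , + 0)) ⊕ (W * (q * q) , + 0)
      ≡⟨⟩
    (p * p - W * (+ 1 * (p * q)) + W * (q * q) , + 0)
      ≡⟨ cong (_, + 0) (solve (W ∷ p ∷ q ∷ [])) ⟩
    (p * p + W * q * q - W * p * q , + 0) ∎
    where open ≡-Reasoning

  conic-sqrt-int : ∀ W p q → conicᵂ W (+ 0 , q) (p , + 0) ≡ (p * p + W * q * q - W * p * q , + 0)
  conic-sqrt-int W p q = begin
    conicᵂ W (+ 0 , q) (p , + 0)
      ≡⟨ cong₂ (λ A B → (A ⊖ mulᵂ W √w B) ⊕ mulᵂ W (p , + 0) (p , + 0)) (sqrt·sqrt W q q) (sqrt·int W q p) ⟩
    ((W * (q * q) , + 0) ⊖ mulᵂ W √w (+ 0 , q * p)) ⊕ mulᵂ W (p , + 0) (p , + 0)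
      ≡⟨ cong₂ (λ B C → ((W * (q * q) , + 0) ⊖ B) ⊕ C) (sqrt·sqrt W (+ 1) (q * p)) (int·int W p p) ⟩
    ((W * (q * q) , + 0) ⊖ (W * (+ 1 * (q * p)) , + 0)) ⊕ (p * p , + 0)
      ≡⟨⟩
    (W * (q * q) - W * (+ 1 * (q * p)) + p * p , + 0)
      ≡⟨ cong (_, + 0) (solve (W ∷ p ∷ q ∷ [])) ⟩
    (p * p + W * q * q - W * p * q , + 0) ∎
    where open ≡-Reasoning

  onConic-ℤ : ∀ p q → OnConic w p q → + p * + p + + w * + q * + q - + w * + p * + q ≡ + 1
  onConic-ℤ p q eq = begin
    + p * + p + + w * + q * + q - + w * + p * + q
      ≡⟨ cong₂ (λ A B → A + B - + w * + p * + q) (sym (pos-* p p)) (sym (pos-*³ w q q)) ⟩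
    + (p ℕ.* p) + + (w ℕ.* q ℕ.* q) - + w * + p * + q
      ≡⟨ cong (_- + w * + p * + q) (sym (pos-+ (p ℕ.* p) (w ℕ.* q ℕ.* q))) ⟩
    + (p ℕ.* p ℕ.+ w ℕ.* q ℕ.* q) - + w * + p * + q
      ≡⟨ cong (λ t → + t - + w * + p * + q) eq ⟩
    + (1 ℕ.+ w ℕ.* p ℕ.* q) - + w * + p * + q
      ≡⟨ cong (_- + w * + p * + q) (trans (pos-+ 1 (w ℕ.* p ℕ.* q)) (cong (λ t → + 1 + t) (pos-*³ w p q))) ⟩
    + 1 + + w * + p * + q - + w * + p * + q
      ≡⟨ cancel (+ 1) (+ w * + p * + q) ⟩
    + 1 ∎
    where
    open ≡-Reasoning
    pos-*³ : ∀ a b c → + (a ℕ.* b ℕ.* c) ≡ + a * + b * + c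
    pos-*³ a b c = trans (pos-* (a ℕ.* b) c) (cong (_* + c) (pos-* a b))
    cancel : ∀ a c → a + c - c ≡ a
    cancel = solve-∀

  int-minus-√w : ∀ m n → (m , + 0) ⊖ (√w ⊛ (n , + 0)) ≡ (m , - n)
  int-minus-√w m n =
    trans (cong ((m , + 0) ⊖_) (√w·int n)) (cong₂ _,_ (+-identityʳ m) (+-identityˡ (- n)))

  √w-minus-int : ∀ m n → (√w ⊛ (m , + 0)) ⊖ (n , + 0) ≡ (- n , m)
  √w-minus-int m n =
    trans (cong (_⊖ (n , + 0)) (√w·int m)) (cong₂ _,_ (+-identityˡ (- n)) (+-identityʳ m))

  pos-int-minus-√w : ∀ u v → v ℕ.* v ℕ.* w ℕ.< u ℕ.* u → Posℝ w (+ u , - + v)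
  pos-int-minus-√w zero    zero    ()
  pos-int-minus-√w (suc u) zero    _   = inj₁ (+≤+ z≤n , +≤+ z≤n , λ { (() , _) })
  pos-int-minus-√w u       (suc v) gap =
    inj₂ (inj₁ (+≤+ z≤n , -<+ , subst₂ _<_ (pos-* (suc v ℕ.* suc v) w) (pos-* u u) (+<+ gap)))

  pos-√w-minus-int : ∀ u v → v ℕ.* v ℕ.< u ℕ.* u ℕ.* w → Posℝ w (- + v , + u)
  pos-√w-minus-int zero    zero    ()
  pos-√w-minus-int (suc u) zero    _   = inj₁ (+≤+ z≤n , +≤+ z≤n , λ { (_ , ()) })
  pos-√w-minus-int u       (suc v) gap =
    inj₂ (inj₂ (-<+ , +≤+ z≤n ,
      subst (_ <_) (trans (pos-* (u ℕ.* u) w) (cong (_* + w) (pos-* u u))) (+<+ gap)))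

  inR : ∀ u v → OnConic w u v → v ℕ.* v ℕ.* w ℕ.< u ℕ.* u → InR w ((+ u , + 0) , (+ 0 , + v))
  inR u v onConic gap = u , v , ≈ℝ-refl (+ u , + 0) , ≡⇒≈ℝ (sym (√w·int (+ v))) , onC
    , subst (Posℝ w) (sym (int-minus-√w (+ u) (+ v))) (pos-int-minus-√w u v gap)
    where
    onC : InC w ((+ u , + 0) , (+ 0 , + v))
    onC = ≡⇒≈ℝ (trans (conic-int-sqrt (+ w) (+ u) (+ v)) (cong (_, + 0) (onConic-ℤ u v onConic)))

  inL : ∀ u v → OnConic w v u → v ℕ.* v ℕ.< u ℕ.* u ℕ.* w → InL w ((+ 0 , + u) , (+ v , + 0))
  inL u v onConic gap = u , v , ≡⇒≈ℝ (sym (√w·int (+ u))) , ≈ℝ-refl (+ v , + 0) , onC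
    , subst (Posℝ w) (sym (√w-minus-int (+ u) (+ v))) (pos-√w-minus-int u v gap)
    where
    onC : InC w ((+ 0 , + u) , (+ v , + 0))
    onC = ≡⇒≈ℝ (trans (conic-sqrt-int (+ w) (+ v) (+ u)) (cong (_, + 0) (onConic-ℤ v u onConic)))

module ClosedForm (k : ℕ) where
  open import Data.Nat as ℕ using (zero; suc; _≤_; s≤s; z≤n)
  open import Data.Nat.Properties using (*-suc; +-comm)
  open import Data.Integer using (+_; _+_; _-_; _*_)
  open import Data.Integer.Properties using (pos-+; pos-*)
  open import Data.Integer.Tactic.RingSolver using (solve-∀)
  open import Data.Product using (_,_)
  open import Data.Sum using (inj₁; inj₂)
  open Defs using (a; P; InR; InL; InE)
  open NatArith using (parity)
  open Recurrence k
  open RootW w using (_⊛_; _⊖_; √w; √w·int; √w·sqrt; inR; inL)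

  pos-+-minus : ∀ m n → + (m ℕ.+ n) - + m ≡ + n
  pos-+-minus m n = trans (cong (_- + m) (pos-+ m n)) (cancel (+ m) (+ n))
    where
    cancel : ∀ i j → i + j - i ≡ j
    cancel = solve-∀

  a-even : ∀ n → a w (2 ℕ.* n) ≡ (+ 0 , + y n)
  a-odd  : ∀ n → a w (suc (2 ℕ.* n)) ≡ (+ u n , + 0)

  a-even zero    = refl
  a-even (suc n) = begin
    a w (2 ℕ.* suc n)                              ≡⟨ cong (a w) (*-suc 2 n) ⟩
    (√w ⊛ a w (suc (2 ℕ.* n))) ⊖ a w (2 ℕ.* n)     ≡⟨ cong₂ (λ x z → (√w ⊛ x) ⊖ z) (a-odd n) (a-even n) ⟩
    (√w ⊛ (+ u n , + 0)) ⊖ (+ 0 , + y n)          ≡⟨ cong (_⊖ (+ 0 , + y n)) (√w·int (+ u n)) ⟩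
    (+ 0 , + u n - + y n)                          ≡⟨ cong (+ 0 ,_) (pos-+-minus (y n) (y (suc n))) ⟩
    (+ 0 , + y (suc n))                            ∎
    where open ≡-Reasoning

  a-odd zero    = refl
  a-odd (suc n) = begin
    a w (suc (2 ℕ.* suc n))                          ≡⟨ cong (λ m → a w (suc m)) (*-suc 2 n) ⟩
    (√w ⊛ a w (2 ℕ.+ 2 ℕ.* n)) ⊖ a w (suc (2 ℕ.* n)) ≡⟨ cong (λ m → (√w ⊛ a w m) ⊖ a w (suc (2 ℕ.* n))) (sym (*-suc 2 n)) ⟩
    (√w ⊛ a w (2 ℕ.* suc n)) ⊖ a w (suc (2 ℕ.* n))   ≡⟨ cong₂ (λ x z → (√w ⊛ x) ⊖ z) (a-even (suc n)) (a-odd n) ⟩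
    (√w ⊛ (+ 0 , + y (suc n))) ⊖ (+ u n , + 0)      ≡⟨ cong (_⊖ (+ u n , + 0)) (√w·sqrt (+ y (suc n))) ⟩
    (+ w * + y (suc n) - + u n , + 0)                ≡⟨ cong (_, + 0) odd-step ⟩
    (+ u (suc n) , + 0)                              ∎
    where
    open ≡-Reasoning
    odd-step : + w * + y (suc n) - + u n ≡ + u (suc n)
    odd-step = trans (cong (_- + u n) (trans (sym (pos-* w (y (suc n)))) (cong +_ (y-rec n))))
                     (pos-+-minus (u n) (u (suc n)))

  a-even-suc : ∀ n → a w (2 ℕ.+ 2 ℕ.* n) ≡ (+ 0 , + y (suc n))
  a-even-suc n = trans (cong (a w) (sym (*-suc 2 n))) (a-even (suc n))

  odd-points-in-R : (n : ℕ) → InR w (P w (2 ℕ.* n ℕ.+ 1))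
  odd-points-in-R n =
    subst (λ m → InR w (P w m)) (sym (+-comm (2 ℕ.* n) 1))
      (subst (InR w) (sym (cong₂ _,_ (a-odd n) (a-even n)))
        (inR (u n) (y n) (odd-onConic n) (odd-gap n)))

  even-points-in-L : (n : ℕ) → 1 ≤ n → InL w (P w (2 ℕ.* n))
  even-points-in-L (suc n) _ =
    subst (λ m → InL w (P w m)) (sym (*-suc 2 n))
      (subst (InL w) (sym (cong₂ _,_ (a-even-suc n) (a-odd n)))
        (inL (y (suc n)) (u n) (even-onConic n) (even-gap n)))

  points-in-E : (n : ℕ) → 1 ≤ n → InE w (P w n)
  points-in-E n 1≤n with parity n
  ... | inj₁ (m , refl) = inj₂ (odd-points-in-R m)
  ... | inj₂ (suc m , refl) = inj₁ (even-points-in-L (suc m) (s≤s z≤n))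
  points-in-E .0 () | inj₂ (zero , refl)

open Defs using (InR; InL; InE; P)
open import Data.Nat using (_≤_; _+_; _*_; suc; s≤s; z≤n)
open import Data.Product using (_×_; _,_)

corollary1 : (w : ℕ) → 4 ≤ w →
    ((n : ℕ) → InR w (P w (2 * n + 1)))
    × ((n : ℕ) → 1 ≤ n → InL w (P w (2 * n)))
    × ((n : ℕ) → 1 ≤ n → InE w (P w n))
corollary1 (suc (suc (suc (suc k)))) (s≤s (s≤s (s≤s (s≤s z≤n)))) =
  odd-points-in-R , even-points-in-L , points-in-E
  where open ClosedForm k
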